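{- Let $n,d$ be integers with $n-1\ge d\ge 3$, and let $\mathcal K_n^d$ be the complete $d$-uniform hypergraph on $n$ vertices. (i) For $1\le k\le d-2$, $EI^k(\mathcal K_n^d)=\mathcal K_n^{d-k}\cup\mathcal K_n^{d-k-1}\cup\dots\cup\mathcal K_n^{t_k}$, where $t_k=\max\{2,\,2^k(d-n)+n\}$. (ii) $k^{EI}(\mathcal K_n^d)=d-1$.
   Context: $\mathcal K_n^r$ denotes the hypergraph with vertex set $\{v_1,\dots,v_n\}$ whose hyperedges are all $r$-element subsets of the vertex set; all these hypergraphs share the vertex set $\{v_1,\dots,v_n\}$, and their union is the hypergraph on that vertex set whose edge set is the union of their edge sets. For a hypergraph $\mathcal H=(V,\mathcal E)$, $EI(\mathcal H)=(V,\mathcal E^{EI})$ with $\mathcal E^{EI}=\{e_1\cap e_2 \mid e_1,e_2\in\mathcal E,\ e_1\neq e_2,\ |e_1\cap e_2|\ge 2\}$; $EI^0(\mathcal H)=\mathcal H$, $EI^k(\mathcal H)=EI(EI^{k-1}(\mathcal H))$. The EI-number $k^{EI}(\mathcal H)$ is the smallest nonnegative integer $k$ such that $EI^k(\mathcal H)$ has no hyperedges. -}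

module Defs where

open import Level using (0ℓ)
open import Data.Nat using (ℕ; zero; suc; _+_; _*_; _∸_; _^_; _≤_; _<_; _⊔_)
open import Data.Fin.Subset using (Subset; _∩_; ∣_∣)
open import Data.Product using (Σ; _×_; ∃-syntax)
open import Relation.Binary.PropositionalEquality using (_≡_; _≢_)
open import Relation.Nullary using (¬_)

Hypergraph : ℕ → Set₁
Hypergraph n = Subset n → Set

K : (n r : ℕ) → Hypergraph n
K n r e = ∣ e ∣ ≡ r

KUnion : (n a b : ℕ) → Hypergraph n
KUnion n a b e = ∃[ r ] (a ≤ r × r ≤ b × K n r e)

EI : ∀ {n} → Hypergraph n → Hypergraph n
EI H e = ∃[ e₁ ] ∃[ e₂ ] (H e₁ × H e₂ × e₁ ≢ e₂ × 2 ≤ ∣ e₁ ∩ e₂ ∣ × e ≡ e₁ ∩ e₂)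

EI^ : ∀ {n} → ℕ → Hypergraph n → Hypergraph n
EI^ zero H = H
EI^ (suc k) H = EI (EI^ k H)

SameEdges : ∀ {n} → Hypergraph n → Hypergraph n → Set
SameEdges H G = ∀ e → (H e → G e) × (G e → H e)

NoEdges : ∀ {n} → Hypergraph n → Set
NoEdges H = ∀ e → ¬ H e

IsEINumber : ∀ {n} → Hypergraph n → ℕ → Set
IsEINumber H k = NoEdges (EI^ k H) × (∀ j → j < k → ¬ NoEdges (EI^ j H))

-- t_k = max{2, 2^k (d - n) + n}; for d ≤ n this equals max{2, n ∸ 2^k (n ∸ d)}
-- (truncated subtraction only matters when the value is < 2, where max gives 2).
t : (n d k : ℕ) → ℕ
t n d k = 2 ⊔ (n ∸ (2 ^ k) * (n ∸ d))

-- An edge of EI of the layers 𝒦_n^a ∪ … ∪ 𝒦_n^b is the intersection of two distinct sets with sizes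
-- in [a, b]; its size s is at most b − 1 (distinctness) and at least 2a − n (inclusion–exclusion).
-- Conversely every set of such a size s ≥ 2 is the intersection of two sets of size max(s + 1, a)
-- extending it disjointly. Hence EI sends the layers [a, b] to the layers [max(2, 2a − n), b − 1].
-- Starting from a = b = d, the defect n − a doubles at each step, which yields
-- t_k = max(2, n − 2^k (n − d)) and the upper layer d − k; the layers run out once d − k < 2.
module Submission where

open import Defs
open import Data.Nat
open import Data.Nat.Properties
open import Data.Product using (Σ-syntax; ∃-syntax; _×_; _,_; proj₁; proj₂)
open import Function using (_∘_)
open import Data.Vec using ([]; _∷_)
open import Data.Fin.Subset using (Subset; _∩_; ∣_∣; inside; outside; ⊥)
open import Data.Fin.Subset.Properties using (∣p∣≤n; ∣⊥∣≡0; ∩-idem; ∣p∩q∣≤∣p∣; ∣p∩q∣≤∣q∣)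
open import Relation.Binary.PropositionalEquality
open import Relation.Nullary using (¬_; yes; no; contradiction)

∣p∣+∣q∣≤∣p∩q∣+n : ∀ {n} (p q : Subset n) → ∣ p ∣ + ∣ q ∣ ≤ ∣ p ∩ q ∣ + n
∣p∣+∣q∣≤∣p∩q∣+n [] [] = z≤n
∣p∣+∣q∣≤∣p∩q∣+n {suc n} (inside ∷ p) (inside ∷ q)
  rewrite +-suc ∣ p ∣ ∣ q ∣ | +-suc ∣ p ∩ q ∣ n = s≤s (s≤s (∣p∣+∣q∣≤∣p∩q∣+n p q))
∣p∣+∣q∣≤∣p∩q∣+n {suc n} (inside ∷ p) (outside ∷ q)
  rewrite +-suc ∣ p ∩ q ∣ n = s≤s (∣p∣+∣q∣≤∣p∩q∣+n p q)
∣p∣+∣q∣≤∣p∩q∣+n {suc n} (outside ∷ p) (inside ∷ q)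
  rewrite +-suc ∣ p ∣ ∣ q ∣ | +-suc ∣ p ∩ q ∣ n = s≤s (∣p∣+∣q∣≤∣p∩q∣+n p q)
∣p∣+∣q∣≤∣p∩q∣+n {suc n} (outside ∷ p) (outside ∷ q) =
  ≤-trans (∣p∣+∣q∣≤∣p∩q∣+n p q) (+-monoʳ-≤ ∣ p ∩ q ∣ (n≤1+n n))

∣p∩q∣≡∣p∣≡∣q∣⇒p≡q : ∀ {n} (p q : Subset n) → ∣ p ∩ q ∣ ≡ ∣ p ∣ → ∣ p ∩ q ∣ ≡ ∣ q ∣ → p ≡ q
∣p∩q∣≡∣p∣≡∣q∣⇒p≡q [] [] _ _ = refl
∣p∩q∣≡∣p∣≡∣q∣⇒p≡q (inside ∷ p) (inside ∷ q) eqp eqq =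
  cong (inside ∷_) (∣p∩q∣≡∣p∣≡∣q∣⇒p≡q p q (suc-injective eqp) (suc-injective eqq))
∣p∩q∣≡∣p∣≡∣q∣⇒p≡q (inside ∷ p) (outside ∷ q) eqp _ =
  contradiction (subst (_≤ ∣ p ∣) eqp (∣p∩q∣≤∣p∣ p q)) (n≮n ∣ p ∣)
∣p∩q∣≡∣p∣≡∣q∣⇒p≡q (outside ∷ p) (inside ∷ q) _ eqq =
  contradiction (subst (_≤ ∣ q ∣) eqq (∣p∩q∣≤∣q∣ p q)) (n≮n ∣ q ∣)
∣p∩q∣≡∣p∣≡∣q∣⇒p≡q (outside ∷ p) (outside ∷ q) eqp eqq =
  cong (outside ∷_) (∣p∩q∣≡∣p∣≡∣q∣⇒p≡q p q eqp eqq)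

p≢q⇒∣p∩q∣<∣p∣⊔∣q∣ : ∀ {n} (p q : Subset n) → p ≢ q → ∣ p ∩ q ∣ < ∣ p ∣ ⊔ ∣ q ∣
p≢q⇒∣p∩q∣<∣p∣⊔∣q∣ p q p≢q with ∣ p ∩ q ∣ ≟ ∣ p ∣ | ∣ p ∩ q ∣ ≟ ∣ q ∣
... | yes eqp | yes eqq = contradiction (∣p∩q∣≡∣p∣≡∣q∣⇒p≡q p q eqp eqq) p≢q
... | no neqp | _       = <-≤-trans (≤∧≢⇒< (∣p∩q∣≤∣p∣ p q) neqp) (m≤m⊔n ∣ p ∣ ∣ q ∣)
... | yes _   | no neqq = <-≤-trans (≤∧≢⇒< (∣p∩q∣≤∣q∣ p q) neqq) (m≤n⊔m ∣ p ∣ ∣ q ∣)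

∣s∣<∣p∣⇒p≢q : ∀ {n} {s p q : Subset n} → ∣ s ∣ < ∣ p ∣ → p ∩ q ≡ s → p ≢ q
∣s∣<∣p∣⇒p≢q {p = p} ∣s∣<∣p∣ p∩p≡s refl =
  <-irrefl (cong ∣_∣ (trans (sym p∩p≡s) (∩-idem p))) ∣s∣<∣p∣

subset-of-size : ∀ {n r} → r ≤ n → Σ[ p ∈ Subset n ] ∣ p ∣ ≡ r
subset-of-size {n} {zero} _ = ⊥ , ∣⊥∣≡0 n
subset-of-size {suc n} {suc r} (s≤s r≤n) with subset-of-size r≤n
... | p , ∣p∣≡r = inside ∷ p , cong suc ∣p∣≡r

disjoint-extensions : ∀ {n} (s : Subset n) (x y : ℕ) → x + y + ∣ s ∣ ≤ n →
  Σ[ p ∈ Subset n ] Σ[ q ∈ Subset n ] ∣ p ∣ ≡ x + ∣ s ∣ × ∣ q ∣ ≡ y + ∣ s ∣ × p ∩ q ≡ s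
disjoint-extensions [] zero zero _ = [] , [] , refl , refl , refl
disjoint-extensions {suc n} (inside ∷ s) x y le
  with disjoint-extensions s x y (s≤s⁻¹ (subst (_≤ suc n) (+-suc (x + y) ∣ s ∣) le))
... | p , q , ∣p∣ , ∣q∣ , p∩q =
  inside ∷ p , inside ∷ q , trans (cong suc ∣p∣) (sym (+-suc x _)) ,
  trans (cong suc ∣q∣) (sym (+-suc y _)) , cong (inside ∷_) p∩q
disjoint-extensions (outside ∷ s) (suc x) y le with disjoint-extensions s x y (s≤s⁻¹ le)
... | p , q , ∣p∣ , ∣q∣ , p∩q = inside ∷ p , outside ∷ q , cong suc ∣p∣ , ∣q∣ , cong (outside ∷_) p∩q
disjoint-extensions (outside ∷ s) zero (suc y) le with disjoint-extensions s zero y (s≤s⁻¹ le)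
... | p , q , ∣p∣ , ∣q∣ , p∩q = outside ∷ p , inside ∷ q , ∣p∣ , cong suc ∣q∣ , cong (outside ∷_) p∩q
disjoint-extensions (outside ∷ s) zero zero _ with disjoint-extensions s zero zero (∣p∣≤n s)
... | p , q , ∣p∣ , ∣q∣ , p∩q = outside ∷ p , outside ∷ q , ∣p∣ , ∣q∣ , cong (outside ∷_) p∩q

sameEdges-trans : ∀ {n} {H G F : Hypergraph n} → SameEdges H G → SameEdges G F → SameEdges H F
sameEdges-trans H≅G G≅F e =
  (λ h → proj₁ (G≅F e) (proj₁ (H≅G e) h)) , (λ f → proj₂ (H≅G e) (proj₂ (G≅F e) f))

sameEdges-sym : ∀ {n} {H G : Hypergraph n} → SameEdges H G → SameEdges G H
sameEdges-sym H≅G e = proj₂ (H≅G e) , proj₁ (H≅G e)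

sameEdges-NoEdges : ∀ {n} {H G : Hypergraph n} → SameEdges H G → NoEdges G → NoEdges H
sameEdges-NoEdges H≅G noG e h = noG e (proj₁ (H≅G e) h)

EI-cong : ∀ {n} {H G : Hypergraph n} → SameEdges H G → SameEdges (EI H) (EI G)
EI-cong H≅G e =
  (λ (p , q , hp , hq , rest) → p , q , proj₁ (H≅G p) hp , proj₁ (H≅G q) hq , rest) ,
  (λ (p , q , gp , gq , rest) → p , q , proj₂ (H≅G p) gp , proj₂ (H≅G q) gq , rest)

K≅KUnion : ∀ n r → SameEdges (K n r) (KUnion n r r)
K≅KUnion n r e =
  (λ ∣e∣≡r → r , ≤-refl , ≤-refl , ∣e∣≡r) ,
  (λ (_ , r≤s , s≤r , ∣e∣≡s) → trans ∣e∣≡s (≤-antisym s≤r r≤s))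

KUnion-empty : ∀ {n a b} → b < a → NoEdges (KUnion n a b)
KUnion-empty b<a e (r , a≤r , r≤b , _) = <⇒≱ b<a (≤-trans a≤r r≤b)

KUnion-nonempty : ∀ {n a b} → a ≤ b → b ≤ n → ¬ NoEdges (KUnion n a b)
KUnion-nonempty {b = b} a≤b b≤n noEdges with subset-of-size b≤n
... | p , ∣p∣≡b = noEdges p (b , a≤b , ≤-refl , ∣p∣≡b)

EI-KUnion-⊆ : ∀ {n a b} e → EI (KUnion n a (suc b)) e → KUnion n (2 ⊔ (2 * a ∸ n)) b e
EI-KUnion-⊆ {n} {a} .(p ∩ q)
  (p , q , (_ , a≤∣p∣ , ∣p∣≤1+b , refl) , (_ , a≤∣q∣ , ∣q∣≤1+b , refl) , p≢q , 2≤∣p∩q∣ , refl) =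
  ∣ p ∩ q ∣ , ⊔-lub 2≤∣p∩q∣ (m≤n+o⇒m∸n≤o (2 * a) n 2a≤n+∣p∩q∣) ,
  s≤s⁻¹ (≤-trans (p≢q⇒∣p∩q∣<∣p∣⊔∣q∣ p q p≢q) (⊔-lub ∣p∣≤1+b ∣q∣≤1+b)) , refl
  where
  open ≤-Reasoning
  2a≤n+∣p∩q∣ : 2 * a ≤ n + ∣ p ∩ q ∣
  2a≤n+∣p∩q∣ = begin
    2 * a                 ≡⟨ cong (a +_) (+-identityʳ a) ⟩
    a + a                 ≤⟨ +-mono-≤ a≤∣p∣ a≤∣q∣ ⟩
    ∣ p ∣ + ∣ q ∣         ≤⟨ ∣p∣+∣q∣≤∣p∩q∣+n p q ⟩
    ∣ p ∩ q ∣ + n         ≡⟨ +-comm ∣ p ∩ q ∣ n ⟩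
    n + ∣ p ∩ q ∣         ∎

m∸n≤o⇒m≤o+n : ∀ {m n o} → m ∸ n ≤ o → m ≤ o + n
m∸n≤o⇒m≤o+n {m} {n} {o} m∸n≤o =
  ≤-trans (m≤n+m∸n m n) (subst (_≤ o + n) (+-comm (m ∸ n) n) (+-monoˡ-≤ n m∸n≤o))

extension-size : ∀ {n a b s} → 2 * a ≤ s + n → s ≤ b → a ≤ suc b → suc b < n →
  ∃[ x ] (1 ≤ x × a ≤ x + s × x + s ≤ suc b × x + x + s ≤ n)
extension-size {n} {a} {b} {s} 2a≤s+n s≤b a≤1+b 1+b<n with a ≤? suc s
... | yes a≤1+s = 1 , ≤-refl , a≤1+s , s≤s s≤b , ≤-trans (s≤s (s≤s s≤b)) 1+b<n
... | no a≰1+s = x , m<n⇒0<n∸m s<a , ≤-reflexive (sym x+s≡a) , ≤-trans (≤-reflexive x+s≡a) a≤1+b ,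
                 +-cancelˡ-≤ s (x + x + s) n room
  where
  open ≤-Reasoning
  x = a ∸ s
  s<a : s < a
  s<a = <-trans (n<1+n s) (≰⇒> a≰1+s)
  x+s≡a : x + s ≡ a
  x+s≡a = m∸n+n≡m (<⇒≤ s<a)
  room : s + (x + x + s) ≤ s + n
  room = begin
    s + (x + x + s) ≡⟨ cong (s +_) (+-assoc x x s) ⟩
    s + (x + (x + s)) ≡⟨ cong (λ y → s + (x + y)) x+s≡a ⟩
    s + (x + a)     ≡⟨ sym (+-assoc s x a) ⟩
    s + x + a       ≡⟨ cong (_+ a) (trans (+-comm s x) x+s≡a) ⟩
    a + a           ≡⟨ cong (a +_) (sym (+-identityʳ a)) ⟩
    2 * a           ≤⟨ 2a≤s+n ⟩
    s + n           ∎

EI-KUnion-⊇ : ∀ {n a b} → a ≤ suc b → suc b < n →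
  ∀ e → KUnion n (2 ⊔ (2 * a ∸ n)) b e → EI (KUnion n a (suc b)) e
EI-KUnion-⊇ {n} {a} a≤1+b 1+b<n e (_ , lo , ∣e∣≤b , refl)
  with extension-size (m∸n≤o⇒m≤o+n (m⊔n≤o⇒n≤o 2 (2 * a ∸ n) lo)) ∣e∣≤b a≤1+b 1+b<n
... | x , 1≤x , a≤x+∣e∣ , x+∣e∣≤1+b , room with disjoint-extensions e x x room
... | p , q , ∣p∣≡ , ∣q∣≡ , p∩q≡e =
  p , q , (_ , a≤x+∣e∣ , x+∣e∣≤1+b , ∣p∣≡) , (_ , a≤x+∣e∣ , x+∣e∣≤1+b , ∣q∣≡) ,
  ∣s∣<∣p∣⇒p≢q (subst (∣ e ∣ <_) (sym ∣p∣≡) (m<n+m ∣ e ∣ 1≤x)) p∩q≡e ,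
  subst (λ s → 2 ≤ ∣ s ∣) (sym p∩q≡e) (m⊔n≤o⇒m≤o 2 (2 * a ∸ n) lo) , sym p∩q≡e

EI-KUnion : ∀ {n a b} → a ≤ suc b → suc b < n →
  SameEdges (EI (KUnion n a (suc b))) (KUnion n (2 ⊔ (2 * a ∸ n)) b)
EI-KUnion a≤1+b 1+b<n e = EI-KUnion-⊆ e , EI-KUnion-⊇ a≤1+b 1+b<n e

2⊔[2*[2⊔[n∸m]]∸n]≡2⊔[n∸2*m] : ∀ n m → 2 ≤ n → 2 ⊔ (2 * (2 ⊔ (n ∸ m)) ∸ n) ≡ 2 ⊔ (n ∸ 2 * m)
2⊔[2*[2⊔[n∸m]]∸n]≡2⊔[n∸2*m] n m 2≤n with 2 ≤? n ∸ m
... | yes 2≤n∸m = cong (2 ⊔_) (begin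
  2 * (2 ⊔ (n ∸ m)) ∸ n ≡⟨ cong (λ y → 2 * y ∸ n) (m≤n⇒m⊔n≡n 2≤n∸m) ⟩
  2 * (n ∸ m) ∸ n       ≡⟨ cong (_∸ n) (*-distribˡ-∸ 2 n m) ⟩
  2 * n ∸ 2 * m ∸ n     ≡⟨ ∸-+-assoc (2 * n) (2 * m) n ⟩
  2 * n ∸ (2 * m + n)   ≡⟨ cong (2 * n ∸_) (+-comm (2 * m) n) ⟩
  2 * n ∸ (n + 2 * m)   ≡⟨ sym (∸-+-assoc (2 * n) n (2 * m)) ⟩
  2 * n ∸ n ∸ 2 * m     ≡⟨ cong (_∸ 2 * m) (trans (m+n∸m≡n n (n + 0)) (+-identityʳ n)) ⟩
  n ∸ 2 * m             ∎)
  where open ≡-Reasoning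
... | no 2≰n∸m = begin
  2 ⊔ (2 * (2 ⊔ (n ∸ m)) ∸ n) ≡⟨ cong (λ y → 2 ⊔ (2 * y ∸ n)) (m≥n⇒m⊔n≡m n∸m≤2) ⟩
  2 ⊔ (4 ∸ n)                 ≡⟨ m≥n⇒m⊔n≡m (∸-monoʳ-≤ 4 2≤n) ⟩
  2                           ≡⟨ sym (m≥n⇒m⊔n≡m (≤-trans (∸-monoʳ-≤ n (m≤n*m m 2)) n∸m≤2)) ⟩
  2 ⊔ (n ∸ 2 * m)             ∎
  where
  open ≡-Reasoning
  n∸m≤2 : n ∸ m ≤ 2
  n∸m≤2 = <⇒≤ (≰⇒> 2≰n∸m)

t-zero : ∀ {n d} → d ≤ n → 2 ≤ d → t n d 0 ≡ d
t-zero {n} {d} d≤n 2≤d rewrite +-identityʳ (n ∸ d) | m∸[m∸n]≡n d≤n = m≤n⇒m⊔n≡n 2≤d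

t-suc : ∀ {n d} k → 2 ≤ n → 2 ⊔ (2 * t n d k ∸ n) ≡ t n d (suc k)
t-suc {n} {d} k 2≤n = trans (2⊔[2*[2⊔[n∸m]]∸n]≡2⊔[n∸2*m] n (2 ^ k * (n ∸ d)) 2≤n)
  (cong (λ m → 2 ⊔ (n ∸ m)) (sym (*-assoc 2 (2 ^ k) (n ∸ d))))

k+m≤2^k*m : ∀ k {m} → 1 ≤ m → k + m ≤ 2 ^ k * m
k+m≤2^k*m zero {m} _ = ≤-reflexive (sym (+-identityʳ m))
k+m≤2^k*m (suc k) {m} 1≤m = begin
  1 + (k + m)               ≤⟨ +-mono-≤ (≤-trans 1≤m (m+n≤o⇒n≤o k IH)) IH ⟩
  2 ^ k * m + 2 ^ k * m     ≡⟨ cong (2 ^ k * m +_) (sym (+-identityʳ (2 ^ k * m))) ⟩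
  2 * (2 ^ k * m)           ≡⟨ sym (*-assoc 2 (2 ^ k) m) ⟩
  2 ^ suc k * m             ∎
  where
  open ≤-Reasoning
  IH : k + m ≤ 2 ^ k * m
  IH = k+m≤2^k*m k 1≤m

t≤d∸k : ∀ {n d k} → d < n → 2 + k ≤ d → t n d k ≤ d ∸ k
t≤d∸k {n} {d} {k} d<n 2+k≤d = ⊔-lub (m+n≤o⇒m≤o∸n 2 2+k≤d) (begin
  n ∸ 2 ^ k * (n ∸ d)     ≤⟨ ∸-monoʳ-≤ n (k+m≤2^k*m k (m+n≤o⇒m≤o∸n 1 d<n)) ⟩
  n ∸ (k + (n ∸ d))       ≡⟨ cong (n ∸_) (+-comm k (n ∸ d)) ⟩
  n ∸ (n ∸ d + k)         ≡⟨ sym (∸-+-assoc n (n ∸ d) k) ⟩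
  n ∸ (n ∸ d) ∸ k         ≡⟨ cong (_∸ k) (m∸[m∸n]≡n (<⇒≤ d<n)) ⟩
  d ∸ k                   ∎)
  where open ≤-Reasoning

EI^-K : ∀ {n d} → 2 ≤ d → d < n → ∀ k → k < d →
  SameEdges (EI^ k (K n d)) (KUnion n (t n d k) (d ∸ k))
EI^-K {n} {d} 2≤d d<n zero _ =
  subst (λ a → SameEdges (K n d) (KUnion n a d)) (sym (t-zero (<⇒≤ d<n) 2≤d)) (K≅KUnion n d)
EI^-K {n} {d} 2≤d d<n (suc k) 1+k<d =
  sameEdges-trans (EI-cong previous)
    (subst (λ a → SameEdges (EI (KUnion n (t n d k) (suc (d ∸ suc k)))) (KUnion n a (d ∸ suc k)))
      (t-suc {d = d} k (≤-trans 2≤d (<⇒≤ d<n)))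
      (EI-KUnion (subst (t n d k ≤_) d∸k≡1+d∸[1+k] (t≤d∸k d<n 1+k<d))
                 (subst (_< n) d∸k≡1+d∸[1+k] (≤-<-trans (m∸n≤m d k) d<n))))
  where
  d∸k≡1+d∸[1+k] : d ∸ k ≡ suc (d ∸ suc k)
  d∸k≡1+d∸[1+k] = +-∸-assoc 1 (<⇒≤ 1+k<d)
  previous : SameEdges (EI^ k (K n d)) (KUnion n (t n d k) (suc (d ∸ suc k)))
  previous = subst (λ b → SameEdges (EI^ k (K n d)) (KUnion n (t n d k) b)) d∸k≡1+d∸[1+k]
    (EI^-K 2≤d d<n k (<-trans (n<1+n k) 1+k<d))

theorem5 : (n d : ℕ) → 3 ≤ d → suc d ≤ n →
    ((k : ℕ) → 1 ≤ k → k ≤ d ∸ 2 → SameEdges (EI^ k (K n d)) (KUnion n (t n d k) (d ∸ k)))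
    × IsEINumber (K n d) (d ∸ 1)
theorem5 n d@(suc d′) 3≤d d<n = shape , no-edges , edges
  where
  2≤d : 2 ≤ d
  2≤d = ≤-trans (n≤1+n 2) 3≤d
  shape : (k : ℕ) → 1 ≤ k → k ≤ d ∸ 2 → SameEdges (EI^ k (K n d)) (KUnion n (t n d k) (d ∸ k))
  shape k _ k≤d∸2 = EI^-K 2≤d d<n k (<-≤-trans (m<m+n k 0<1+n) (m≤o∸n⇒m+n≤o k 2≤d k≤d∸2))
  no-edges : NoEdges (EI^ d′ (K n d))
  no-edges = sameEdges-NoEdges (EI^-K 2≤d d<n d′ ≤-refl)
    (subst (λ b → NoEdges (KUnion n (t n d d′) b)) (sym (m+n∸n≡m 1 d′))
      (KUnion-empty (m≤m⊔n 2 (n ∸ 2 ^ d′ * (n ∸ d)))))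
  edges : ∀ j → j < d′ → ¬ NoEdges (EI^ j (K n d))
  edges j j<d′ = KUnion-nonempty (t≤d∸k d<n (s≤s j<d′)) (≤-trans (m∸n≤m d j) (<⇒≤ d<n)) ∘
    sameEdges-NoEdges (sameEdges-sym (EI^-K 2≤d d<n j (<-trans j<d′ (n<1+n d′))))
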